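{- For all integers $k\ge 0$ and $n\ge 1$, $$s_k(n) \ =\ a_k(n-2(k-1)),$$ where $a_k(m)$ is interpreted as $0$ whenever $m\le 0$.
   Context: Let $(F_n)_{n\ge 1}$ be the Fibonacci sequence with $F_1=F_2=1$ and $F_{n+2}=F_{n+1}+F_n$. Define $a_0(n)=F_n$ for $n\ge 1$, and for $k\ge 1$ define $a_k(n)=\sum_{i=1}^n a_{k-1}(i)$ for $n\ge 1$ (the $k$-fold iterated partial sums of the Fibonacci sequence); set $a_k(m)=0$ for $m\le 0$. For $n\ge 1$ and $k\ge 0$ define $$s_k(n) := \#\{S\subseteq \{1,2,\ldots,n\} : |S|\ge k \text{ and } \min S\ge |S|\},$$ where the empty set is regarded as satisfying $\min S\ge |S|$ (so it is counted when $k=0$). -}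

module Defs where

open import Data.Nat using (ℕ; zero; suc; _+_; _*_; _≤_; _≤?_)
open import Data.Integer using (ℤ; +_; -[1+_]; _⊖_)
open import Data.Bool using (Bool; true; false)
open import Data.Vec using (Vec; []; _∷_)
open import Data.List using (List; []; _∷_; map; _++_; length; filter)
open import Data.Maybe using (Maybe; just; nothing)
open import Data.Fin using (Fin; toℕ)
open import Data.Fin.Subset using (Subset; ∣_∣)
open import Relation.Nullary using (Dec; yes; no)
open import Data.Unit using (⊤; tt)

fib : ℕ → ℕ
fib zero = 0
fib (suc zero) = 1
fib (suc (suc n)) = fib (suc n) + fib n

-- a k n : k-fold iterated partial sums; a 0 n = F n for n ≥ 1,
-- a (k+1) n = Σ_{i=1}^n a k i.  Value at n = 0 is 0 (empty sum / a_k(0)=0).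
a : ℕ → ℕ → ℕ
a zero n = fib n
a (suc k) zero = 0
a (suc k) (suc n) = a (suc k) n + a k (suc n)

aℤ : ℕ → ℤ → ℕ
aℤ k (+ m) = a k m   -- a k 0 = 0 for all k
aℤ k -[1+ m ] = 0

-- Subsets of {1,…,n}: Subset n, where Fin index i stands for element i+1.
-- All subsets of {1,…,n} (each exactly once).
allSubsets : (n : ℕ) → List (Subset n)
allSubsets zero = [] ∷ []
allSubsets (suc n) = map (false ∷_) (allSubsets n) ++ map (true ∷_) (allSubsets n)

minS : {n : ℕ} → Subset n → Maybe ℕ
minS [] = nothing
minS (true ∷ s) = just 1
minS (false ∷ s) with minS s
... | just m = just (suc m)
... | nothing = nothing

minCond : {n : ℕ} → Subset n → Set
minCond s with minS s
... | just m = ∣ s ∣ ≤ m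
... | nothing = ⊤

minCond? : {n : ℕ} → (s : Subset n) → Dec (minCond s)
minCond? s with minS s
... | just m = ∣ s ∣ ≤? m
... | nothing = yes tt

data Good (k : ℕ) {n : ℕ} (s : Subset n) : Set where
  good : k ≤ ∣ s ∣ → minCond s → Good k s

good? : (k : ℕ) {n : ℕ} (s : Subset n) → Dec (Good k s)
good? k s with k ≤? ∣ s ∣ | minCond? s
... | yes p | yes q = yes (good p q)
... | no ¬p | _ = no λ { (good p q) → ¬p p }
... | yes _ | no ¬q = no λ { (good p q) → ¬q q }

s : ℕ → ℕ → ℕ
s k n = length (filter (good? k) (allSubsets n))

-- Split the sets counted by s k (n + 2) according to whether they contain n + 2.
-- Those that do not are counted by s k (n + 1). Those that do cannot contain 1
-- (else min S = 1 < 2 ≤ |S|), and deleting n + 2 and subtracting 1 from the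
-- remaining elements lowers both size and minimum by one, giving a bijection with
-- the sets counted by s (k − 1) n. So s k (n + 2) = s k (n + 1) + s (k − 1) n,
-- which after the shift m = n + 2 − 2k is the defining recurrence of a_k (of the
-- Fibonacci numbers when k = 0); the initial values n = 0, 1 are computed.
module Submission where

open import Defs
open import Data.Nat using (ℕ; suc; _+_; _*_)
open import Data.Integer using (_⊖_)
open import Relation.Binary.PropositionalEquality using (_≡_)

open import Level using (0ℓ)
open import Data.Nat using (zero; pred; _≤_; _∸_; z≤n; s≤s; s≤s⁻¹)
open import Data.Nat.Properties
  using (+-comm; +-identityʳ; +-commutativeSemigroup; *-suc; n≮0; m≤n⇒m∸n≡0; pred[m∸n]≡m∸[1+n])
open import Algebra.Properties.CommutativeSemigroup +-commutativeSemigroup using (interchange)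
open import Data.Integer.Properties using ([1+m]⊖[1+n]≡m⊖n)
open import Data.Bool using (Bool; true; false)
open import Data.Maybe using (Maybe; just; nothing; fromMaybe)
open import Data.Product using (_×_; _,_)
open import Data.Product.Function.NonDependent.Propositional using (_×-⇔_)
open import Data.Unit using (⊤; tt)
open import Data.List using (List; []; _∷_; map; _++_; length; filter)
open import Data.List.Properties using (length-++; filter-++; filter-≐; filter-none)
open import Data.List.Relation.Unary.All using (universal)
open import Data.Vec using ([]; _∷_; _∷ʳ_)
open import Data.Fin.Subset using (Subset; ∣_∣)
open import Function using (_∘_; id; _⇔_; mk⇔; Equivalence)
open import Function.Properties.Equivalence using () renaming (refl to ⇔-refl; sym to ⇔-sym)
open import Function.Related.Propositional using (module EquationalReasoning)
open import Relation.Nullary using (¬_; does)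
open import Relation.Unary using (Pred; Decidable)
open import Relation.Binary.PropositionalEquality
  using (refl; sym; trans; cong; cong₂; subst; module ≡-Reasoning)

private variable
  A B : Set
  k n : ℕ

count : {P : Pred A 0ℓ} → Decidable P → List A → ℕ
count P? xs = length (filter P? xs)

count-++ : {P : Pred A 0ℓ} (P? : Decidable P) (xs ys : List A) →
           count P? (xs ++ ys) ≡ count P? xs + count P? ys
count-++ P? xs ys = trans (cong length (filter-++ P? xs ys)) (length-++ (filter P? xs))

count-map : {P : Pred A 0ℓ} (P? : Decidable P) (f : B → A) (xs : List B) →
            count P? (map f xs) ≡ count (P? ∘ f) xs
count-map P? f [] = refl
count-map P? f (x ∷ xs) with does (P? (f x))
... | true  = cong suc (count-map P? f xs)
... | false = count-map P? f xs

count-⇔ : {P Q : Pred A 0ℓ} (P? : Decidable P) (Q? : Decidable Q) →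
          (∀ x → P x ⇔ Q x) → (xs : List A) → count P? xs ≡ count Q? xs
count-⇔ P? Q? P⇔Q =
  cong length ∘ filter-≐ P? Q? (Equivalence.to (P⇔Q _) , Equivalence.from (P⇔Q _))

count-none : {P : Pred A 0ℓ} (P? : Decidable P) → (∀ x → ¬ P x) →
             (xs : List A) → count P? xs ≡ 0
count-none P? ¬P xs = cong length (filter-none P? (universal ¬P xs))

count-allSubsets-∷ : {P : Pred (Subset (suc n)) 0ℓ} (P? : Decidable P) →
  count P? (allSubsets (suc n)) ≡
  count (P? ∘ (false ∷_)) (allSubsets n) + count (P? ∘ (true ∷_)) (allSubsets n)
count-allSubsets-∷ {n} P? =
  trans (count-++ P? (map (false ∷_) (allSubsets n)) (map (true ∷_) (allSubsets n)))
  (cong₂ _+_ (count-map P? (false ∷_) (allSubsets n)) (count-map P? (true ∷_) (allSubsets n)))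

count-allSubsets-∷ʳ : {P : Pred (Subset (suc n)) 0ℓ} (P? : Decidable P) →
  count P? (allSubsets (suc n)) ≡
  count (P? ∘ (_∷ʳ false)) (allSubsets n) + count (P? ∘ (_∷ʳ true)) (allSubsets n)
count-allSubsets-∷ʳ {zero} P? =
  trans (count-++ P? (map (_∷ʳ false) (allSubsets 0)) (map (_∷ʳ true) (allSubsets 0)))
  (cong₂ _+_ (count-map P? (_∷ʳ false) (allSubsets 0)) (count-map P? (_∷ʳ true) (allSubsets 0)))
count-allSubsets-∷ʳ {suc n} P? = begin
  count P? (allSubsets (suc (suc n)))
    ≡⟨ count-allSubsets-∷ P? ⟩
  count (P? ∘ (false ∷_)) (allSubsets (suc n)) + count (P? ∘ (true ∷_)) (allSubsets (suc n))
    ≡⟨ cong₂ _+_ (count-allSubsets-∷ʳ (P? ∘ (false ∷_))) (count-allSubsets-∷ʳ (P? ∘ (true ∷_))) ⟩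
  (#[ false , false ] + #[ false , true ]) + (#[ true , false ] + #[ true , true ])
    ≡⟨ interchange #[ false , false ] #[ false , true ] #[ true , false ] #[ true , true ] ⟩
  (#[ false , false ] + #[ true , false ]) + (#[ false , true ] + #[ true , true ])
    ≡⟨ sym (cong₂ _+_ (count-allSubsets-∷ (P? ∘ (_∷ʳ false))) (count-allSubsets-∷ (P? ∘ (_∷ʳ true)))) ⟩
  count (P? ∘ (_∷ʳ false)) (allSubsets (suc n)) + count (P? ∘ (_∷ʳ true)) (allSubsets (suc n)) ∎
  where
  open ≡-Reasoning
  #[_,_] : Bool → Bool → ℕ
  #[ b , c ] = count (λ t → P? (b ∷ (t ∷ʳ c))) (allSubsets n)

∣s∷ʳfalse∣≡∣s∣ : (s : Subset n) → ∣ s ∷ʳ false ∣ ≡ ∣ s ∣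
∣s∷ʳfalse∣≡∣s∣ []          = refl
∣s∷ʳfalse∣≡∣s∣ (true ∷ s)  = cong suc (∣s∷ʳfalse∣≡∣s∣ s)
∣s∷ʳfalse∣≡∣s∣ (false ∷ s) = ∣s∷ʳfalse∣≡∣s∣ s

∣s∷ʳtrue∣≡1+∣s∣ : (s : Subset n) → ∣ s ∷ʳ true ∣ ≡ suc ∣ s ∣
∣s∷ʳtrue∣≡1+∣s∣ []          = refl
∣s∷ʳtrue∣≡1+∣s∣ (true ∷ s)  = cong suc (∣s∷ʳtrue∣≡1+∣s∣ s)
∣s∷ʳtrue∣≡1+∣s∣ (false ∷ s) = ∣s∷ʳtrue∣≡1+∣s∣ s

minS-∷ʳfalse : (s : Subset n) → minS (s ∷ʳ false) ≡ minS s
minS-∷ʳfalse []          = refl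
minS-∷ʳfalse (true ∷ s)  = refl
minS-∷ʳfalse (false ∷ s) rewrite minS-∷ʳfalse s = refl

minS-∷ʳtrue : (s : Subset n) → minS (s ∷ʳ true) ≡ just (fromMaybe (suc n) (minS s))
minS-∷ʳtrue []          = refl
minS-∷ʳtrue (true ∷ s)  = refl
minS-∷ʳtrue (false ∷ s) rewrite minS-∷ʳtrue s with minS s
... | just m  = refl
... | nothing = refl

minS≡nothing⇒∣s∣≡0 : (s : Subset n) → minS s ≡ nothing → ∣ s ∣ ≡ 0
minS≡nothing⇒∣s∣≡0 []          _ = refl
minS≡nothing⇒∣s∣≡0 (false ∷ s) eq with minS s in eqₛ
... | nothing = minS≡nothing⇒∣s∣≡0 s eqₛ

_≤ᵐ_ : ℕ → Maybe ℕ → Set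
c ≤ᵐ just m  = c ≤ m
c ≤ᵐ nothing = ⊤

minCond≡∣s∣≤ᵐminS : (s : Subset n) → minCond s ≡ (∣ s ∣ ≤ᵐ minS s)
minCond≡∣s∣≤ᵐminS s with minS s
... | just m  = refl
... | nothing = refl

∣s∣≤ᵐminS⇔ : (s : Subset n) → ∣ s ∣ ≤ᵐ minS s ⇔ ∣ s ∣ ≤ fromMaybe (suc n) (minS s)
∣s∣≤ᵐminS⇔ s with minS s in eq
... | just m  = mk⇔ (λ p → p) (λ p → p)
... | nothing = mk⇔ (λ _ → subst (_≤ _) (sym (minS≡nothing⇒∣s∣≡0 s eq)) z≤n) (λ _ → tt)

Good⇔ : (s : Subset n) → Good k s ⇔ (k ≤ ∣ s ∣ × ∣ s ∣ ≤ᵐ minS s)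
Good⇔ s = mk⇔ (λ { (good p q) → p , subst id (minCond≡∣s∣≤ᵐminS s) q })
              (λ { (p , q) → good p (subst id (sym (minCond≡∣s∣≤ᵐminS s)) q) })

k≤1+c⇔pred[k]≤c : {c : ℕ} → k ≤ suc c ⇔ pred k ≤ c
k≤1+c⇔pred[k]≤c {zero}  = mk⇔ (λ _ → z≤n) (λ _ → z≤n)
k≤1+c⇔pred[k]≤c {suc k} = mk⇔ s≤s⁻¹ s≤s

Good-∷ʳfalse : (s : Subset n) → Good k (s ∷ʳ false) ⇔ Good k s
Good-∷ʳfalse {k = k} s = begin
  Good k (s ∷ʳ false)                                    ∼⟨ Good⇔ (s ∷ʳ false) ⟩
  (k ≤ ∣ s ∷ʳ false ∣ × ∣ s ∷ʳ false ∣ ≤ᵐ minS (s ∷ʳ false))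
    ≡⟨ cong₂ (λ c w → k ≤ c × c ≤ᵐ w) (∣s∷ʳfalse∣≡∣s∣ s) (minS-∷ʳfalse s) ⟩
  (k ≤ ∣ s ∣ × ∣ s ∣ ≤ᵐ minS s)                          ∼⟨ ⇔-sym (Good⇔ s) ⟩
  Good k s ∎
  where open EquationalReasoning

minS-false∷ : (s : Subset n) {m : ℕ} → minS s ≡ just m → minS (false ∷ s) ≡ just (suc m)
minS-false∷ s eq rewrite eq = refl

Good-false∷∷ʳtrue : (s : Subset n) → Good k (false ∷ (s ∷ʳ true)) ⇔ Good (pred k) s
Good-false∷∷ʳtrue {n} {k} s = begin
  Good k (false ∷ (s ∷ʳ true))                       ∼⟨ Good⇔ (false ∷ (s ∷ʳ true)) ⟩
  (k ≤ ∣ s ∷ʳ true ∣ × ∣ s ∷ʳ true ∣ ≤ᵐ minS (false ∷ (s ∷ʳ true)))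
    ≡⟨ cong₂ (λ c w → k ≤ c × c ≤ᵐ w) (∣s∷ʳtrue∣≡1+∣s∣ s) (minS-false∷ (s ∷ʳ true) (minS-∷ʳtrue s)) ⟩
  (k ≤ suc ∣ s ∣ × suc ∣ s ∣ ≤ suc m∞)              ∼⟨ k≤1+c⇔pred[k]≤c ×-⇔ mk⇔ s≤s⁻¹ s≤s ⟩
  (pred k ≤ ∣ s ∣ × ∣ s ∣ ≤ m∞)                     ∼⟨ ⇔-refl ×-⇔ ⇔-sym (∣s∣≤ᵐminS⇔ s) ⟩
  (pred k ≤ ∣ s ∣ × ∣ s ∣ ≤ᵐ minS s)                 ∼⟨ ⇔-sym (Good⇔ s) ⟩
  Good (pred k) s ∎
  where
  open EquationalReasoning
  m∞ = fromMaybe (suc n) (minS s)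

¬Good-true∷∷ʳtrue : (s : Subset n) → ¬ Good k (true ∷ (s ∷ʳ true))
¬Good-true∷∷ʳtrue s (good _ size≤min) = n≮0 (subst (_≤ 0) (∣s∷ʳtrue∣≡1+∣s∣ s) (s≤s⁻¹ size≤min))

s-rec : ∀ k n → s k (suc (suc n)) ≡ s k (suc n) + s (pred k) n
s-rec k n = begin
  s k (suc (suc n))
    ≡⟨ count-allSubsets-∷ʳ {suc n} (good? k) ⟩
  count (good? k ∘ (_∷ʳ false)) (allSubsets (suc n)) + count (good? k ∘ (_∷ʳ true)) (allSubsets (suc n))
    ≡⟨ cong₂ _+_ (count-⇔ _ (good? k) Good-∷ʳfalse (allSubsets (suc n)))
                 (count-allSubsets-∷ {n} (good? k ∘ (_∷ʳ true))) ⟩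
  s k (suc n) + (count (λ t → good? k (false ∷ (t ∷ʳ true))) (allSubsets n)
                 + count (λ t → good? k (true ∷ (t ∷ʳ true))) (allSubsets n))
    ≡⟨ cong (s k (suc n) +_) (cong₂ _+_ (count-⇔ _ (good? (pred k)) Good-false∷∷ʳtrue (allSubsets n))
                                        (count-none _ ¬Good-true∷∷ʳtrue (allSubsets n))) ⟩
  s k (suc n) + (s (pred k) n + 0)
    ≡⟨ cong (s k (suc n) +_) (+-identityʳ (s (pred k) n)) ⟩
  s k (suc n) + s (pred k) n ∎
  where open ≡-Reasoning

a[k,0]≡0 : ∀ k → a k 0 ≡ 0
a[k,0]≡0 zero    = refl
a[k,0]≡0 (suc k) = refl

aℤ[m⊖i]≡a[m∸i] : ∀ k m i → aℤ k (m ⊖ i) ≡ a k (m ∸ i)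
aℤ[m⊖i]≡a[m∸i] k m       zero    = refl
aℤ[m⊖i]≡a[m∸i] k zero    (suc i) = sym (a[k,0]≡0 k)
aℤ[m⊖i]≡a[m∸i] k (suc m) (suc i) = trans (cong (aℤ k) ([1+m]⊖[1+n]≡m⊖n m i)) (aℤ[m⊖i]≡a[m∸i] k m i)

a-suc-pred : ∀ k m → a (suc k) m ≡ a (suc k) (pred m) + a k m
a-suc-pred k zero    = sym (a[k,0]≡0 k)
a-suc-pred k (suc m) = refl

a-suc-∸ : ∀ k m i → a (suc k) (m ∸ i) ≡ a (suc k) (m ∸ suc i) + a k (m ∸ i)
a-suc-∸ k m i = trans (a-suc-pred k (m ∸ i)) (cong (λ j → a (suc k) j + a k (m ∸ i)) (pred[m∸n]≡m∸[1+n] m i))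

-- aShift k n = a_k(n + 2 − 2k); truncated subtraction gives the paper's value 0 for
-- nonpositive arguments because a k 0 = 0.
aShift : ℕ → ℕ → ℕ
aShift k n = a k (suc (suc n) ∸ 2 * k)

aShift-suc : ∀ k n → aShift (suc k) n ≡ a (suc k) (n ∸ 2 * k)
aShift-suc k n = cong (λ i → a (suc k) (suc (suc n) ∸ i)) (*-suc 2 k)

aShift-rec : ∀ k n → aShift k (suc (suc n)) ≡ aShift k (suc n) + aShift (pred k) n
aShift-rec zero    n = refl
aShift-rec (suc k) n = begin
  aShift (suc k) (suc (suc n))                              ≡⟨ aShift-suc k (suc (suc n)) ⟩
  a (suc k) (suc (suc n) ∸ 2 * k)                           ≡⟨ a-suc-∸ k (suc (suc n)) (2 * k) ⟩
  a (suc k) (suc n ∸ 2 * k) + a k (suc (suc n) ∸ 2 * k)     ≡⟨ cong (_+ aShift k n) (sym (aShift-suc k (suc n))) ⟩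
  aShift (suc k) (suc n) + aShift k n                       ∎
  where open ≡-Reasoning

aShift-vanishes : ∀ {k n} → n ≤ 2 * k → aShift (suc k) n ≡ 0
aShift-vanishes {k} {n} n≤2k = trans (aShift-suc k n) (cong (a (suc k)) (m≤n⇒m∸n≡0 n≤2k))

s≡aShift : ∀ n k → s k n ≡ aShift k n
s≡aShift 0             0             = refl
s≡aShift 0             1             = refl
s≡aShift 0             (suc (suc k)) = sym (aShift-vanishes {suc k} z≤n)
s≡aShift 1             0             = refl
s≡aShift 1             1             = refl
s≡aShift 1             (suc (suc k)) = sym (aShift-vanishes {suc k} (s≤s z≤n))
s≡aShift (suc (suc n)) k             = begin
  s k (suc (suc n))                    ≡⟨ s-rec k n ⟩
  s k (suc n) + s (pred k) n           ≡⟨ cong₂ _+_ (s≡aShift (suc n) k) (s≡aShift n (pred k)) ⟩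
  aShift k (suc n) + aShift (pred k) n ≡⟨ sym (aShift-rec k n) ⟩
  aShift k (suc (suc n))               ∎
  where open ≡-Reasoning

theorem1p2 : (k n : ℕ) → s k (suc n) ≡ aℤ k ((suc n + 2) ⊖ (2 * k))
theorem1p2 k n = begin
  s k (suc n)                    ≡⟨ s≡aShift (suc n) k ⟩
  a k (2 + suc n ∸ 2 * k)        ≡⟨ cong (λ m → a k (m ∸ 2 * k)) (+-comm 2 (suc n)) ⟩
  a k (suc n + 2 ∸ 2 * k)        ≡⟨ sym (aℤ[m⊖i]≡a[m∸i] k (suc n + 2) (2 * k)) ⟩
  aℤ k ((suc n + 2) ⊖ (2 * k))   ∎
  where open ≡-Reasoning
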